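{- Let $c$ be a Coxeter element of $D_n$ with cycle type $(k_1\,\dots\,k_{2n-2})(1,-1)$, $k_i\in\{\pm2,\dots,\pm n\}$, and let $(r_1,\dots,r_n)$ be a minimal factorization of $c$. Then the chords of its type D folded chord diagram form a connected spanning (multi)graph on the $n$ vertices $[n]$ with $n$ edges, containing a single cycle, this cycle has size at least $2$, and it contains the vertex $1$.
   Context: $D_n$ acts on $\pm[n]$ by signed permutations with an even number of sign changes; its reflections correspond to roots $e_a\pm e_b$ ($a\neq b$), the reflection with root $e_a-e_b$ swapping $a\leftrightarrow b$, $-a\leftrightarrow -b$ and that with root $e_a+e_b$ swapping $a\leftrightarrow -b$, $-a\leftrightarrow b$. The type D folded chord diagram of $(r_1,\dots,r_n)$ is the multigraph on vertex set $[n]$ (with $|k_1|,\dots,|k_{n-1}|$ on an outer circle and $1$ on an inner circle) having, for each $k$, one edge labeled $k$ between $a$ and $b$ where $r_k$ has root $e_a\pm e_b$. A cycle of size $2$ means two parallel edges. -}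

module Defs where

open import Data.Bool using (Bool; true; false; not; if_then_else_)
open import Data.Nat using (ℕ; zero; suc; _+_; _*_; _∸_; _≤_; _<_)
open import Data.Nat.Divisibility using (_∣_)
open import Data.Fin using (Fin; zero; suc; inject₁)
open import Data.Fin.Properties using (_≟_; suc-injective)
open import Data.List using (List; []; _∷_; length; map; allFin; lookup)
open import Data.Nat.ListAction using (sum)
open import Data.List.Membership.Propositional using (_∈_)
open import Data.List.Relation.Unary.Unique.Propositional using (Unique)
open import Data.List.Relation.Binary.Permutation.Propositional using (_↭_)
open import Data.Product using (Σ; ∃; _×_; _,_; proj₁; proj₂)
open import Data.Sum using (_⊎_)
open import Function using (_∘_; id)
open import Relation.Nullary using (¬_; yes; no)
open import Relation.Binary.PropositionalEquality using (_≡_; _≢_; refl; cong)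

-- The set ±[n].  (false , i) stands for +(i+1), (true , i) for -(i+1).
-- So vertex / letter 1 of the paper is `zero : Fin n`.

SInt : ℕ → Set
SInt n = Bool × Fin n

neg : ∀ {n} → SInt n → SInt n
neg (s , i) = (not s , i)

abs : ∀ {n} → SInt n → Fin n
abs = proj₂

signChanges : ∀ {n} → (SInt n → SInt n) → ℕ
signChanges {n} f =
  sum (map (λ i → if proj₁ (f (false , i)) then 1 else 0) (allFin n))

InD : ∀ n → (SInt n → SInt n) → Set
InD n f =
  (∀ x → f (neg x) ≡ neg (f x)) ×
  (Σ (SInt n → SInt n) λ g → (∀ x → g (f x) ≡ x) × (∀ x → f (g x) ≡ x)) ×
  (2 ∣ signChanges f)

-- Roots e_a - e_b (plus = false) and e_a + e_b (plus = true), a ≠ b,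
-- and the corresponding reflections of D_n.

record Root (n : ℕ) : Set where
  constructor mkRoot
  field
    a    : Fin n
    b    : Fin n
    a≢b  : a ≢ b
    plus : Bool

reflect : ∀ {n} → Root n → SInt n → SInt n
reflect (mkRoot a b _ plus) (s , i) with i ≟ a | i ≟ b
... | yes _ | _     = ((if plus then not s else s) , b)
... | no _  | yes _ = ((if plus then not s else s) , a)
... | no _  | no _  = (s , i)

-- product r_1 r_2 ⋯ r_k of reflections (composition of functions:
-- r_k is applied first)
prodR : ∀ {n} → List (Root n) → SInt n → SInt n
prodR []      = id
prodR (ρ ∷ L) = reflect ρ ∘ prodR L

-- Coxeter elements: conjugates (in D_n) of products of all simple
-- reflections, each once, in any order.
-- Simple roots of D_n (n ≥ 2): e_1 + e_2 and e_{i+1} - e_i (1 ≤ i ≤ n-1).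

inject₁≢suc : ∀ {k} (i : Fin k) → inject₁ i ≢ suc i
inject₁≢suc zero    ()
inject₁≢suc (suc i) eq = inject₁≢suc i (suc-injective eq)

zero≢one : ∀ {k} → _≢_ {A = Fin (suc (suc k))} zero (suc zero)
zero≢one ()

simpleRoots : ∀ n → List (Root n)
simpleRoots zero          = []
simpleRoots (suc zero)    = []
simpleRoots (suc (suc k)) =
  mkRoot zero (suc zero) zero≢one true ∷
  map (λ i → mkRoot (inject₁ i) (suc i) (inject₁≢suc i) false) (allFin (suc k))

IsCoxeter : ∀ n → (SInt n → SInt n) → Set
IsCoxeter n c =
  Σ (List (Root n)) λ L → (L ↭ simpleRoots n) ×
  Σ (SInt n → SInt n) λ w → InD n w × (∀ x → c (w x) ≡ w (prodR L x))

-- Cycle type (k_1 … k_{2n-2})(1,-1) with k_i ∈ {±2,…,±n}: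
-- c(1) = -1, c(-1) = 1, and there is k_1 with |k_1| ≥ 2 such that
-- k_j = c^{j-1}(k_1) (j = 1..2n-2) are pairwise distinct, all have
-- |k_j| ≥ 2, and c^{2n-2}(k_1) = k_1.

iter : ∀ {A : Set} → (A → A) → ℕ → A → A
iter f zero    x = x
iter f (suc j) x = f (iter f j x)

HasCycleType : ∀ n → (SInt n → SInt n) → Set
HasCycleType zero    c = Data.Empty.⊥ where import Data.Empty
HasCycleType (suc m) c =
  c (false , zero) ≡ (true , zero) ×
  c (true , zero) ≡ (false , zero) ×
  Σ (SInt (suc m)) λ k₁ →
    (∀ j → j < N → abs (iter c j k₁) ≢ zero) ×
    (∀ i j → i < N → j < N → iter c i k₁ ≡ iter c j k₁ → i ≡ j) ×
    iter c N k₁ ≡ k₁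
  where N = 2 * suc m ∸ 2

IsFactorization : ∀ {n} → (SInt n → SInt n) → List (Root n) → Set
IsFactorization c L = ∀ x → prodR L x ≡ c x

IsMinimalFactorization : ∀ {n} → (SInt n → SInt n) → List (Root n) → Set
IsMinimalFactorization {n} c L =
  IsFactorization c L ×
  (∀ (L' : List (Root n)) → IsFactorization c L' → length L ≤ length L')

Graph : ℕ → ℕ → Set
Graph n m = Fin m → Fin n × Fin n

chordDiagram : ∀ {n} (L : List (Root n)) → Graph n (length L)
chordDiagram L k = (Root.a (lookup L k) , Root.b (lookup L k))

Joins : ∀ {n} → Fin n × Fin n → Fin n → Fin n → Set
Joins (x , y) u v = (x ≡ u × y ≡ v) ⊎ (x ≡ v × y ≡ u)

data Path {n m} (G : Graph n m) : Fin n → Fin n → List (Fin m) → List (Fin n) → Set where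
  nil  : ∀ {u} → Path G u u [] (u ∷ [])
  cons : ∀ {u w v e es vs} → Joins (G e) u w → Path G w v es vs →
         Path G u v (e ∷ es) (u ∷ vs)

Connected : ∀ {n m} → Graph n m → Set
Connected {n} {m} G = ∀ (u v : Fin n) → ∃ λ es → ∃ λ vs → Path G u v es vs

IsCycle : ∀ {n m} → Graph n m → List (Fin m) → Set
IsCycle {n} {m} G []       = Data.Empty.⊥ where import Data.Empty
IsCycle {n} {m} G (e ∷ es) =
  Unique (e ∷ es) ×
  Σ (Fin n) λ u → Σ (Fin n) λ v → Σ (List (Fin n)) λ vs →
    Joins (G e) u v × Path G v u es vs × Unique vs

CycleContains : ∀ {n m} → Graph n m → List (Fin m) → Fin n → Set
CycleContains G C x = ∃ λ e → e ∈ C × (proj₁ (G e) ≡ x ⊎ proj₂ (G e) ≡ x)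

-- same cycle = same set of edges
SameEdges : ∀ {m} → List (Fin m) → List (Fin m) → Set
SameEdges C C' = ∀ e → (e ∈ C → e ∈ C') × (e ∈ C' → e ∈ C)

module Submission where

-- Encode a signed vertex set as vertices K with signs σ. The reflection in
-- e_a ± e_b preserves {σ(v)·v ∣ v ∈ K} iff the chord ab does not leave K and,
-- inside K, its sign is balanced by σ. Since c swaps ±1 and permutes the other
-- 2n − 2 signed integers in one cycle, no nonempty signed set is preserved by
-- all reflections of a factorization of c, and a vertex set closed under all
-- chords is everything; in particular the diagram is connected.
-- A graph with fewer edges than vertices has a balanced component, so a
-- factorization has at least n chords, and conjugated simple reflections give
-- n. With n chords on n vertices there is a cycle. Removing any chord g leaves
-- n − 1 chords with a compatible signed set which g must break; this makes
-- every cycle unbalanced, so an edge of one cycle missing from another cycle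
-- would make that other cycle balanced. If the cycle avoided vertex 1, take the
-- last chord f at 1 on a walk from 1 to the cycle: the signed set left by f
-- either contains the cycle, which would then be balanced, or contains 1 but
-- not the other end of f, which c(1) = −1 rules out.

open import Defs
open import Data.Bool using (Bool; true; false; not; _xor_; if_then_else_)
open import Data.Bool.Properties using (not-¬; not-involutive; xor-comm; xor-same; xor-identityʳ) renaming (_≟_ to _≟ᵇ_)
open import Data.Bool.Solver using (module xor-∧-Solver)
open xor-∧-Solver using (solve; _:+_; _:=_)
open import Data.Nat using (ℕ; zero; suc; _+_; _*_; _∸_; _≤_; _<_; s≤s; z≤n)
import Data.Nat.Properties as ℕ
open import Data.Fin using (Fin; zero; suc; punchIn; punchOut; toℕ; _↑ˡ_; _↑ʳ_; splitAt)
open import Data.Fin.Properties using (_≟_; any?; punchOut-injective; punchOut-cong; punchOut-punchIn; punchIn-punchOut; punchInᵢ≢i; suc-injective; ¬Fin0; injective⇒≤; toℕ-injective; toℕ<n; splitAt-↑ˡ; splitAt-↑ʳ)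
open import Data.List using (List; []; _∷_; _++_; map; foldr; length; lookup; allFin)
open import Data.List.Properties using (length-map; length-tabulate)
open import Data.List.Relation.Binary.Permutation.Propositional.Properties using (↭-length)
open import Data.List.Membership.Propositional using (_∈_; _∉_; find; lose)
open import Data.List.Membership.Propositional.Properties using (∈-++⁻; ∈-insert; ∈-map⁻)
import Data.List.Membership.DecPropositional as DecMembership
open import Data.List.Relation.Unary.Any using (here; there)
import Data.List.Relation.Unary.Any as Any
open import Data.List.Relation.Unary.All using (All; []; _∷_)
import Data.List.Relation.Unary.All as All
open import Data.List.Relation.Unary.All.Properties using (¬Any⇒All¬)
open import Data.List.Relation.Unary.AllPairs using ([]; _∷_)
open import Data.List.Relation.Unary.Unique.Propositional using (Unique)
import Data.List.Relation.Unary.Unique.Propositional.Properties as Unique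
open import Data.Product using (Σ; ∃; ∃₂; _×_; _,_; proj₁; proj₂; map₂; swap; uncurry) renaming (map to map-×)
open import Data.Sum using (_⊎_; inj₁; inj₂; [_,_]′) renaming (map to map-⊎)
open import Data.Empty using (⊥; ⊥-elim)
open import Function using (_∘_)
open import Relation.Nullary using (¬_; yes; no; Dec; does; contradiction)
open import Relation.Nullary.Decidable using (_⊎-dec_)
open import Relation.Binary.PropositionalEquality using (_≡_; _≢_; refl; sym; trans; cong; cong₂; subst; module ≡-Reasoning)

xor-flip-both : ∀ f x y → (f xor x) xor (f xor y) ≡ x xor y
xor-flip-both = solve 3 (λ f x y → (f :+ x) :+ (f :+ y) := x :+ y) refl

xor-telescope : ∀ x w y → (x xor w) xor (w xor y) ≡ x xor y
xor-telescope = solve 3 (λ x w y → (x :+ w) :+ (w :+ y) := x :+ y) refl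

-- By cases, not by the solver: this proof ends up inside the roots built by
-- `conjugate`, which Agda normalises when rewriting.
xor-cancelˡ : ∀ x y → (x xor y) xor x ≡ y
xor-cancelˡ false y = xor-identityʳ y
xor-cancelˡ true  y = trans (xor-comm (not y) true) (not-involutive y)

xor-cancelʳ : ∀ x y → (x xor y) xor y ≡ x
xor-cancelʳ x y = trans (cong (_xor y) (xor-comm x y)) (xor-cancelˡ y x)

xor-balance : ∀ p x y → p ≡ x xor ((p xor (x xor y)) xor y)
xor-balance = solve 3 (λ p x y → p := x :+ ((p :+ (x :+ y)) :+ y)) refl

xor-conjugate : ∀ p s ta tb → (p xor (ta xor tb)) xor (s xor ta) ≡ (p xor s) xor tb
xor-conjugate = solve 4 (λ p s ta tb → (p :+ (ta :+ tb)) :+ (s :+ ta) := (p :+ s) :+ tb) refl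

unique-middle : ∀ {A : Set} (xs : List A) {y ys} → Unique (xs ++ y ∷ ys) → y ∉ xs × y ∉ ys
unique-middle []       u         = (λ ()) , Unique.Unique[x∷xs]⇒x∉xs u
unique-middle (x ∷ xs) (x∉ ∷ u) =
  (λ { (here refl) → All.lookup x∉ (∈-insert xs) refl ; (there y∈xs) → proj₁ (unique-middle xs u) y∈xs }) ,
  proj₂ (unique-middle xs u)

merge : ∀ {k} {x y : Fin (suc k)} → y ≢ x → Fin (suc k) → Fin k
merge {y = y} y≢x z with z ≟ y
... | yes _  = punchOut y≢x
... | no z≢y = punchOut (z≢y ∘ sym)

module _ {k} {x y : Fin (suc k)} (y≢x : y ≢ x) where

  merge-identifies : merge y≢x x ≡ merge y≢x y
  merge-identifies with x ≟ y | y ≟ y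
  ... | yes x≡y | _     = contradiction (sym x≡y) y≢x
  ... | no _    | yes _ = punchOut-cong y refl
  ... | no _    | no y≢y = contradiction refl y≢y

  merge-identifies-only : ∀ z w → merge y≢x z ≡ merge y≢x w → z ≢ w →
                          (z ≡ x × w ≡ y) ⊎ (z ≡ y × w ≡ x)
  merge-identifies-only z w eq z≢w with z ≟ y | w ≟ y
  ... | yes z≡y | yes w≡y = contradiction (trans z≡y (sym w≡y)) z≢w
  ... | yes z≡y | no w≢y  = inj₂ (z≡y , sym (punchOut-injective y≢x (w≢y ∘ sym) eq))
  ... | no z≢y  | yes w≡y = inj₁ (punchOut-injective (z≢y ∘ sym) y≢x eq , w≡y)
  ... | no z≢y  | no w≢y  = contradiction (punchOut-injective (z≢y ∘ sym) (w≢y ∘ sym) eq) z≢w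

  merge-punchIn : ∀ t → merge y≢x (punchIn y t) ≡ t
  merge-punchIn t with punchIn y t ≟ y
  ... | yes eq = contradiction eq (punchInᵢ≢i y t)
  ... | no _   = trans (punchOut-cong y refl) (punchOut-punchIn y)

merge-zero : ∀ {k} {x : Fin (suc (suc k))} {y} (y≢x : suc y ≢ x) → merge y≢x zero ≡ zero
merge-zero {y = y} y≢x with zero ≟ suc y
... | no _ = refl

-- Walks in multigraphs

_∈?_ : ∀ {n} (x : Fin n) xs → Dec (x ∈ xs)
_∈?_ = DecMembership._∈?_ _≟_

Reachable : ∀ {n m} → Graph n m → Fin n → Fin n → Set
Reachable G u v = ∃₂ λ es vs → Path G u v es vs

module _ {n m} {G : Graph n m} where

  joins-end : ∀ {e u w} → Joins (G e) u w → proj₁ (G e) ≡ u ⊎ proj₂ (G e) ≡ u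
  joins-end = map-⊎ proj₁ proj₂

  joins-transport : (P : Fin n → Fin n → Set) → (∀ {x y} → P x y → P y x) →
                    ∀ {e u w} → Joins (G e) u w → P u w → P (proj₁ (G e)) (proj₂ (G e))
  joins-transport P P-sym (inj₁ (refl , refl)) p = p
  joins-transport P P-sym (inj₂ (refl , refl)) p = P-sym p

  joins-transport⁻¹ : (P : Fin n → Fin n → Set) → (∀ {x y} → P x y → P y x) →
                      ∀ {e u w} → Joins (G e) u w → P (proj₁ (G e)) (proj₂ (G e)) → P u w
  joins-transport⁻¹ P P-sym (inj₁ (refl , refl)) p = p
  joins-transport⁻¹ P P-sym (inj₂ (refl , refl)) p = P-sym p

  path-source∈ : ∀ {u v es vs} → Path G u v es vs → u ∈ vs
  path-source∈ nil        = here refl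
  path-source∈ (cons _ _) = here refl

  path-edge-ends∈ : ∀ {u v es vs f} → Path G u v es vs → f ∈ es →
                    proj₁ (G f) ∈ vs × proj₂ (G f) ∈ vs
  path-edge-ends∈ (cons (inj₁ (refl , refl)) p) (here refl) = here refl , there (path-source∈ p)
  path-edge-ends∈ (cons (inj₂ (refl , refl)) p) (here refl) = there (path-source∈ p) , here refl
  path-edge-ends∈ (cons _ p) (there f∈es) = map-× there there (path-edge-ends∈ p f∈es)

  _++ᵖ_ : ∀ {u v w es es′ vs vs′} → Path G u v es vs → Path G v w es′ vs′ →
          ∃ λ vs″ → Path G u w (es ++ es′) vs″
  nil ++ᵖ q = _ , q
  cons j p ++ᵖ q = _ , cons j (proj₂ (p ++ᵖ q))

  path-split : ∀ {s t es vs g} → Path G s t es vs → g ∈ es →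
               ∃₂ λ x y → ∃₂ λ es₁ es₂ → es ≡ es₁ ++ g ∷ es₂ ×
               (∃ λ vs₁ → Path G s x es₁ vs₁) × Joins (G g) x y × (∃ λ vs₂ → Path G y t es₂ vs₂)
  path-split (cons j p) (here refl) = _ , _ , [] , _ , refl , (_ , nil) , j , (_ , p)
  path-split (cons j p) (there g∈es) with path-split p g∈es
  ... | x , y , es₁ , es₂ , refl , (_ , p₁) , jg , p₂ = x , y , _ ∷ es₁ , es₂ , refl , (_ , cons j p₁) , jg , p₂

  path-after-last-visit : ∀ {x s t es vs} → Path G s t es vs → t ≢ x → x ∈ vs →
    ∃₂ λ f w → Joins (G f) x w × ∃₂ λ es′ vs′ → Path G w t es′ vs′ × x ∉ vs′
  path-after-last-visit nil t≢x (here refl) = contradiction refl t≢x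
  path-after-last-visit {x} (cons {e = e} {vs = vs} j p) t≢x x∈ with x ∈? vs
  ... | yes x∈vs = path-after-last-visit p t≢x x∈vs
  ... | no x∉vs with x∈
  ...   | here refl  = e , _ , j , _ , vs , p , x∉vs
  ...   | there x∈vs = contradiction x∈vs x∉vs

  path-suffix : ∀ {x u v es vs} → Path G u v es vs → Unique vs → x ∈ vs →
                ∃₂ λ es′ vs′ → Path G x v es′ vs′ × Unique vs′
  path-suffix nil        uvs       (here refl)  = _ , _ , nil , uvs
  path-suffix (cons j p) uvs       (here refl)  = _ , _ , cons j p , uvs
  path-suffix (cons _ p) (_ ∷ uvs) (there x∈vs) = path-suffix p uvs x∈vs

  path-simple : ∀ {u v es vs} → Path G u v es vs → ∃₂ λ es′ vs′ → Path G u v es′ vs′ × Unique vs′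
  path-simple nil = _ , _ , nil , [] ∷ []
  path-simple {u} (cons j p) with path-simple p
  ... | _ , vs′ , p′ , uvs′ with u ∈? vs′
  ... | yes u∈vs′ = path-suffix p′ uvs′ u∈vs′
  ... | no u∉vs′  = _ , _ , cons j p′ , ¬Any⇒All¬ vs′ u∉vs′ ∷ uvs′

  path-edges-unique : ∀ {u v es vs} → Path G u v es vs → Unique vs → Unique es
  path-edges-unique nil _ = []
  path-edges-unique (cons j p) (u∉vs ∷ uvs) = All.tabulate e≢ ∷ path-edges-unique p uvs
    where
    e≢ : ∀ {f} → f ∈ _ → _ ≢ f
    e≢ f∈es refl with joins-end j | path-edge-ends∈ p f∈es
    ... | inj₁ refl | a∈vs , _ = All.lookup u∉vs a∈vs refl
    ... | inj₂ refl | _ , b∈vs = All.lookup u∉vs b∈vs refl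

  cycle-detour : ∀ {C g} → IsCycle G C → g ∈ C →
                 ∃₂ λ x y → Joins (G g) x y × ∃₂ λ es vs → Path G y x es vs × g ∉ es
  cycle-detour {e ∷ es} (e∉es ∷ _ , u , v , vs , j , p , _) (here refl) =
    u , v , j , es , vs , p , λ e∈es → All.lookup e∉es e∈es refl
  cycle-detour {e ∷ es} (e∉es ∷ ues , u , v , vs , j , p , _) (there g∈es)
    with path-split p g∈es
  ... | x , y , es₁ , es₂ , refl , (_ , p₁) , jg , (_ , p₂) =
    x , y , jg , es₂ ++ e ∷ es₁ , _ , proj₂ (p₂ ++ᵖ cons j p₁) , g∉
    where
    g∉ : _ ∉ es₂ ++ e ∷ es₁
    g∉ g∈ with ∈-++⁻ es₂ g∈
    ... | inj₁ g∈es₂          = proj₂ (unique-middle es₁ ues) g∈es₂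
    ... | inj₂ (here refl)    = All.lookup e∉es (∈-insert es₁) refl
    ... | inj₂ (there g∈es₁) = proj₁ (unique-middle es₁ ues) g∈es₁

  cycle-length≥2 : (∀ e → proj₁ (G e) ≢ proj₂ (G e)) → ∀ {C} → IsCycle G C → 2 ≤ length C
  cycle-length≥2 loopless {e ∷ []} (_ , _ , _ , _ , j , nil , _) = contradiction (loop j) (loopless e)
    where
    loop : ∀ {u} → Joins (G e) u u → proj₁ (G e) ≡ proj₂ (G e)
    loop (inj₁ (p , q)) = trans p (sym q)
    loop (inj₂ (p , q)) = trans p (sym q)
  cycle-length≥2 loopless {_ ∷ _ ∷ _} _ = s≤s (s≤s z≤n)

Closed : ∀ {n} → (Fin n → Set) → Fin n × Fin n → Set
Closed K p = (K (proj₁ p) → K (proj₂ p)) × (K (proj₂ p) → K (proj₁ p))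

module _ {n m} {G : Graph n m} {K : Fin n → Set} where

  joins-closed : ∀ {e u w} → Joins (G e) u w → Closed K (G e) → Closed K (u , w)
  joins-closed = joins-transport⁻¹ {G = G} (λ x y → Closed K (x , y)) swap

  path-closed : ∀ {u v es vs} → Path G u v es vs → (∀ {f} → f ∈ es → Closed K (G f)) → Closed K (u , v)
  path-closed nil        _  = (λ k → k) , (λ k → k)
  path-closed (cons j p) cl with joins-closed j (cl (here refl)) | path-closed p (cl ∘ there)
  ... | to₁ , from₁ | to₂ , from₂ = to₂ ∘ to₁ , from₁ ∘ from₂

  path-vertices-in : ∀ {u v es vs} → Path G u v es vs → (∀ {f} → f ∈ es → Closed K (G f)) →
                     K u → ∀ {w} → w ∈ vs → K w
  path-vertices-in nil        _  k (here refl) = k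
  path-vertices-in (cons _ _) _  k (here refl) = k
  path-vertices-in (cons j p) cl k (there w∈vs) =
    path-vertices-in p (cl ∘ there) (proj₁ (joins-closed j (cl (here refl))) k) w∈vs

cycle-closed-inside : ∀ {n m} {G : Graph n m} {K : Fin n → Set} {e es} → IsCycle G (e ∷ es) →
  (∀ {f} → f ∈ e ∷ es → Closed K (G f)) → K (proj₁ (G e)) → ∀ {f} → f ∈ e ∷ es → K (proj₁ (G f))
cycle-closed-inside {G = G} {K} (_ , u , v , _ , j , p , _) closed a∈K (here refl) = a∈K
cycle-closed-inside {G = G} {K} (_ , u , v , _ , j , p , _) closed a∈K (there f∈es) =
  path-vertices-in p (closed ∘ there) (proj₁ (joins-closed {G = G} {K = K} j (closed (here refl))) u∈K) (proj₁ (path-edge-ends∈ p f∈es))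
  where
  u∈K : K u
  u∈K = proj₁ (joins-transport⁻¹ {G = G} (λ x y → K x × K y) swap j
                (a∈K , proj₁ (closed (here refl)) a∈K))

module _ {n m} {G : Graph n m} (s : Fin m → Bool) (σ : Fin n → Bool) where

  path-parity : ∀ {u v es vs} → Path G u v es vs →
                (∀ {f} → f ∈ es → s f ≡ σ (proj₁ (G f)) xor σ (proj₂ (G f))) →
                foldr _xor_ false (map s es) ≡ σ u xor σ v
  path-parity {u} nil _ = sym (xor-same (σ u))
  path-parity {u} {v} (cons {w = w} {e = e} j p) bal =
    trans (cong₂ _xor_ (edge j (bal (here refl))) (path-parity p (bal ∘ there))) (xor-telescope (σ u) (σ w) (σ v))
    where
    edge : ∀ {x y} → Joins (G e) x y → s e ≡ σ (proj₁ (G e)) xor σ (proj₂ (G e)) → s e ≡ σ x xor σ y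
    edge (inj₁ (refl , refl)) b = b
    edge (inj₂ (refl , refl)) b = trans b (xor-comm (σ (proj₁ (G e))) (σ (proj₂ (G e))))

module _ {n m} {G : Graph n (suc m)} where

  path-lift : ∀ {u v es vs} → Path (G ∘ suc) u v es vs → Path G u v (map suc es) vs
  path-lift nil        = nil
  path-lift (cons j p) = cons j (path-lift p)

  cycle-lift : ∀ {C} → IsCycle (G ∘ suc) C → IsCycle G (map suc C)
  cycle-lift {_ ∷ _} (uC , u , v , vs , j , p , uvs) = Unique.map⁺ suc-injective uC , u , v , vs , j , path-lift p , uvs

-- Cycles in graphs with many edges

reachable-trans : ∀ {n m} {G : Graph n m} {u v w} → Reachable G u v → Reachable G v w → Reachable G u w
reachable-trans (_ , _ , p) (_ , _ , q) = _ , p ++ᵖ q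

record ConnectedLabelling {n m} (G : Graph n m) : Set where
  field
    labels      : ℕ
    label-count : labels + m ≡ n
    label       : Fin n → Fin labels
    reachable   : ∀ u v → label u ≡ label v → Reachable G u v

cycle-or-labelling : ∀ {n} m (G : Graph n m) → ∃ (IsCycle G) ⊎ ConnectedLabelling G
cycle-or-labelling {n} zero G = inj₂ (record
  { labels = n ; label-count = ℕ.+-identityʳ n ; label = λ v → v
  ; reachable = λ { u .u refl → [] , _ , nil } })
cycle-or-labelling (suc m) G with cycle-or-labelling m (G ∘ suc)
... | inj₁ (C , cyc) = inj₁ (map suc C , cycle-lift cyc)
... | inj₂ L = add-edge L
  where
  a = proj₁ (G zero)
  b = proj₂ (G zero)
  lifted : ∀ {u v} → Reachable (G ∘ suc) u v → Reachable G u v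
  lifted (_ , _ , p) = _ , _ , path-lift p
  via-edge : ∀ {u v x y} → Joins (G zero) x y → Reachable (G ∘ suc) u x → Reachable (G ∘ suc) y v →
             Reachable G u v
  via-edge j ux yv = reachable-trans (lifted ux) (reachable-trans (_ , _ , cons j nil) (lifted yv))
  add-edge : ConnectedLabelling (G ∘ suc) → ∃ (IsCycle G) ⊎ ConnectedLabelling G
  add-edge record { labels = zero ; label = lab } = ⊥-elim (¬Fin0 (lab a))
  add-edge record { labels = suc k ; label-count = count ; label = lab ; reachable = reach }
    with lab a ≟ lab b
  ... | yes same with reach b a (sym same)
  ...   | _ , _ , p with path-simple p
  ...     | es , vs , p′ , uvs = inj₁ (zero ∷ map suc es ,
            (¬Any⇒All¬ _ zero∉ ∷ Unique.map⁺ suc-injective (path-edges-unique p′ uvs)) ,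
            a , b , vs , inj₁ (refl , refl) , path-lift p′ , uvs)
    where
    zero∉ : zero ∉ map suc es
    zero∉ z∈ with ∈-map⁻ suc z∈
    ... | _ , _ , ()
  add-edge record { labels = suc k ; label-count = count ; label = lab ; reachable = reach }
    | no differ = inj₂ (record
    { labels = k ; label-count = trans (ℕ.+-suc k m) count ; label = merge b≢a ∘ lab
    ; reachable = reachable′ })
    where
    b≢a : lab b ≢ lab a
    b≢a = differ ∘ sym
    reachable′ : ∀ u v → merge b≢a (lab u) ≡ merge b≢a (lab v) → Reachable G u v
    reachable′ u v eq with lab u ≟ lab v
    ... | yes same = lifted (reach u v same)
    ... | no u≁v with merge-identifies-only b≢a (lab u) (lab v) eq u≁v
    ...   | inj₁ (ua , vb) = via-edge (inj₁ (refl , refl)) (reach u a ua) (reach b v (sym vb))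
    ...   | inj₂ (ub , va) = via-edge (inj₂ (refl , refl)) (reach u b ub) (reach a v (sym va))

cycle-of-many-edges : ∀ {n m} (G : Graph (suc n) m) → suc n ≤ m → ∃ (IsCycle G)
cycle-of-many-edges {n} {m} G n<m with cycle-or-labelling m G
... | inj₁ cyc = cyc
... | inj₂ record { labels = zero ; label = lab } = ⊥-elim (¬Fin0 (lab zero))
... | inj₂ record { labels = suc k ; label-count = count } =
  ⊥-elim (ℕ.n≮n m (ℕ.≤-trans (s≤s (ℕ.m≤n+m m k)) (ℕ.≤-trans (ℕ.≤-reflexive count) n<m)))

-- Balanced signed vertex sets

ends : ∀ {n} → Root n → Fin n × Fin n
ends r = Root.a r , Root.b r

Balanced : ∀ {n} → (Fin n → Bool) → Root n → Set
Balanced σ r = Root.plus r ≡ σ (Root.a r) xor σ (Root.b r)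

-- the reflection of r maps the signed set {σ(v)·v ∣ v ∈ K} onto itself
Compatible : ∀ {n} → (Fin n → Set) → (Fin n → Bool) → Root n → Set
Compatible K σ r = Closed K (ends r) × (K (Root.a r) → Balanced σ r)

compatible-outside : ∀ {n} {K : Fin n → Set} {σ} {r : Root n} →
                     ¬ K (Root.a r) → ¬ K (Root.b r) → Compatible K σ r
compatible-outside a∉K b∉K = ((⊥-elim ∘ a∉K) , (⊥-elim ∘ b∉K)) , (⊥-elim ∘ a∉K)

-- Class zero absorbs the components that are not balanced; every other class
-- is nonempty, closed under the edges and balanced by sign.
record BalancedPartition {n m} (E : Fin m → Root n) (k : ℕ) : Set where
  field
    class    : Fin n → Fin (suc k)
    sign     : Fin n → Bool
    occupied : ∀ j → ∃ λ v → class v ≡ suc j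
    inside   : ∀ e → class (Root.a (E e)) ≡ class (Root.b (E e))
    balanced : ∀ e → class (Root.a (E e)) ≢ zero → Balanced sign (E e)

module _ {n m} (E : Fin (suc m) → Root n) where
  open BalancedPartition
  private
    a = Root.a (E zero)
    b = Root.b (E zero)

  keep-partition : ∀ {k} (P : BalancedPartition (E ∘ suc) k) → class P a ≡ class P b →
                   (class P a ≢ zero → Balanced (sign P) (E zero)) → BalancedPartition E k
  keep-partition P same bal = record
    { class = class P ; sign = sign P ; occupied = occupied P
    ; inside = λ { zero → same ; (suc e) → inside P e }
    ; balanced = λ { zero → bal ; (suc e) → balanced P e } }

  merge-partition : ∀ {k} (P : BalancedPartition (E ∘ suc) (suc k)) {x} {y} (y≢x : suc y ≢ x)
    (σ : Fin n → Bool) → (∀ u v → class P u ≡ class P v → σ u xor σ v ≡ sign P u xor sign P v) →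
    merge y≢x (class P a) ≡ merge y≢x (class P b) →
    (merge y≢x (class P a) ≢ zero → Balanced σ (E zero)) → BalancedPartition E k
  merge-partition P {y = y} y≢x σ same-xor same bal = record
    { class = merge y≢x ∘ class P ; sign = σ
    ; occupied = λ j → map₂ (λ eq → trans (cong (merge y≢x) eq) (merge-punchIn y≢x (suc j)))
                                          (occupied P (punchIn y j))
    ; inside = λ { zero → same ; (suc e) → cong (merge y≢x) (inside P e) }
    ; balanced = λ { zero → bal
                   ; (suc e) nz → trans (balanced P e (nz ∘ zero-to-zero)) (sym (same-xor _ _ (inside P e))) } }
    where
    zero-to-zero : ∀ {z} → z ≡ zero → merge y≢x z ≡ zero
    zero-to-zero refl = merge-zero y≢x

  -- the new edge touches class zero or unbalances class suc y, which joins class zero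
  kill-class : ∀ {k} (P : BalancedPartition (E ∘ suc) (suc k)) y →
    (class P a ≡ zero ⊎ class P a ≡ suc y) → (class P b ≡ zero ⊎ class P b ≡ suc y) → BalancedPartition E k
  kill-class P y ha hb =
    merge-partition P y≢0 (sign P) (λ _ _ _ → refl) (trans (dies ha) (sym (dies hb))) (λ nz → contradiction (dies ha) nz)
    where
    y≢0 : suc y ≢ zero
    y≢0 ()
    dies : ∀ {z} → z ≡ zero ⊎ z ≡ suc y → merge y≢0 z ≡ zero
    dies (inj₁ refl) = merge-zero y≢0
    dies (inj₂ refl) = trans (sym (merge-identifies y≢0)) (merge-zero y≢0)

  partition-add-edge : ∀ {k} → BalancedPartition (E ∘ suc) k → ∃ λ k′ → k ≤ suc k′ × BalancedPartition E k′
  partition-add-edge {k} P with class P a in ca | class P b in cb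
  ... | zero  | zero  = k , ℕ.n≤1+n k , keep-partition P (trans ca (sym cb)) (λ nz → contradiction ca nz)
  partition-add-edge {suc k} P | zero  | suc j = k , ℕ.≤-refl , kill-class P j (inj₁ ca) (inj₂ cb)
  partition-add-edge {suc k} P | suc i | zero  = k , ℕ.≤-refl , kill-class P i (inj₂ ca) (inj₁ cb)
  partition-add-edge {suc k} P | suc i | suc j with i ≟ j | Root.plus (E zero) ≟ᵇ (sign P a xor sign P b)
  ... | yes refl | yes bal = suc k , ℕ.n≤1+n (suc k) , keep-partition P (trans ca (sym cb)) (λ _ → bal)
  ... | yes refl | no _    = k , ℕ.≤-refl , kill-class P i (inj₂ ca) (inj₂ cb)
  -- class suc j joins class suc i, its signs flipped if that balances the new edge
  ... | no i≢j   | _       = k , ℕ.≤-refl ,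
    merge-partition P j≢i σ same-xor (trans (cong (merge j≢i) ca) (trans (merge-identifies j≢i) (sym (cong (merge j≢i) cb)))) (λ _ → bal)
    where
    j≢i : suc j ≢ suc i
    j≢i = i≢j ∘ sym ∘ suc-injective
    flag = Root.plus (E zero) xor (sign P a xor sign P b)
    σ : Fin n → Bool
    σ v = if does (class P v ≟ suc j) then flag xor sign P v else sign P v
    same-xor : ∀ u v → class P u ≡ class P v → σ u xor σ v ≡ sign P u xor sign P v
    same-xor u v eq rewrite eq with class P v ≟ suc j
    ... | yes _ = xor-flip-both flag (sign P u) (sign P v)
    ... | no _  = refl
    bal : Balanced σ (E zero)
    bal with class P a ≟ suc j | class P b ≟ suc j
    ... | yes a∈j | _     = contradiction (suc-injective (trans (sym ca) a∈j)) i≢j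
    ... | no _    | no b∉j = contradiction cb b∉j
    ... | no _    | yes _  = xor-balance (Root.plus (E zero)) (sign P a) (sign P b)

balanced-partition : ∀ {n} m (E : Fin m → Root n) → ∃ λ k → n ≤ k + m × BalancedPartition E k
balanced-partition {n} zero E = n , ℕ.≤-reflexive (sym (ℕ.+-identityʳ n)) , record
  { class = suc ; sign = λ _ → false ; occupied = λ j → j , refl ; inside = λ () ; balanced = λ () }
balanced-partition (suc m) E with balanced-partition m (E ∘ suc)
... | k , bound , P with partition-add-edge E P
...   | k′ , k≤ , P′ = k′ , ℕ.≤-trans bound (ℕ.≤-trans (ℕ.+-monoˡ-≤ m k≤) (ℕ.≤-reflexive (sym (ℕ.+-suc k′ m)))) , P′

record CompatibleSet {n m} (E : Fin m → Root n) : Set₁ where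
  field
    member     : Fin n → Set
    member?    : ∀ v → Dec (member v)
    sign       : Fin n → Bool
    nonempty   : ∃ member
    compatible : ∀ e → Compatible member sign (E e)

compatible-set-of-few-edges : ∀ {n m} (E : Fin m → Root n) → m < n → CompatibleSet E
compatible-set-of-few-edges {n} {m} E m<n with balanced-partition m E
... | zero  , bound , _ = contradiction bound (ℕ.<⇒≱ m<n)
... | suc k , _ , P = record
  { member = λ v → class P v ≡ suc zero ; member? = λ v → class P v ≟ suc zero
  ; sign = sign P ; nonempty = occupied P zero
  ; compatible = λ e → (trans (sym (inside P e)) , trans (inside P e)) , λ a∈ → balanced P e (λ a∈0 → 1≢0 (trans (sym a∈) a∈0)) }
  where
  open BalancedPartition
  1≢0 : suc {suc k} zero ≢ zero
  1≢0 ()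

-- Reflections acting on signed vertex sets

InSigned : ∀ {n} → (Fin n → Set) → (Fin n → Bool) → SInt n → Set
InSigned K σ y = K (abs y) × σ (abs y) ≡ proj₁ y

if-not≡xor : ∀ p s → (if p then not s else s) ≡ p xor s
if-not≡xor false s = refl
if-not≡xor true  s = refl

reflect-view : ∀ {n} (r : Root n) s i →
  (i ≡ Root.a r × reflect r (s , i) ≡ (Root.plus r xor s , Root.b r)) ⊎
  (i ≡ Root.b r × reflect r (s , i) ≡ (Root.plus r xor s , Root.a r)) ⊎
  (i ≢ Root.a r × i ≢ Root.b r × reflect r (s , i) ≡ (s , i))
reflect-view (mkRoot a b _ p) s i with i ≟ a | i ≟ b
... | yes i≡a | _       = inj₁ (i≡a , cong (_, b) (if-not≡xor p s))
... | no _    | yes i≡b = inj₂ (inj₁ (i≡b , cong (_, a) (if-not≡xor p s)))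
... | no i≢a  | no i≢b  = inj₂ (inj₂ (i≢a , i≢b , refl))

module _ {n} {K : Fin n → Set} {r : Root n} where

  reflect-closed : Closed K (ends r) → ∀ y → K (abs y) → K (abs (reflect r y))
  reflect-closed (to , from) (s , i) k with reflect-view r s i
  ... | inj₁ (refl , eq)             rewrite eq = to k
  ... | inj₂ (inj₁ (refl , eq))      rewrite eq = from k
  ... | inj₂ (inj₂ (_ , _ , eq))     rewrite eq = k

  reflect-compatible : ∀ {σ} → Compatible K σ r → ∀ y → InSigned K σ y → InSigned K σ (reflect r y)
  reflect-compatible {σ} ((to , from) , bal) (s , i) (k , refl) with reflect-view r s i
  ... | inj₁ (refl , eq)         rewrite eq =
        to k , trans (sym (xor-cancelˡ (σ i) _)) (cong (_xor σ i) (sym (bal k)))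
  ... | inj₂ (inj₁ (refl , eq))  rewrite eq =
        from k , trans (sym (xor-cancelʳ _ (σ i))) (cong (_xor σ i) (sym (bal (from k))))
  ... | inj₂ (inj₂ (_ , _ , eq)) rewrite eq = k , refl

  reflect-separating : ∀ {σ} → ¬ (K (Root.a r) × K (Root.b r)) → ∀ y → InSigned K σ y →
                       InSigned K σ (reflect r y) ⊎ ¬ K (abs (reflect r y))
  reflect-separating sep (s , i) (k , sg) with reflect-view r s i
  ... | inj₁ (refl , eq)         rewrite eq = inj₂ (λ kb → sep (k , kb))
  ... | inj₂ (inj₁ (refl , eq))  rewrite eq = inj₂ (λ ka → sep (ka , k))
  ... | inj₂ (inj₂ (_ , _ , eq)) rewrite eq = inj₁ (k , sg)

closed-complement : ∀ {n} {K : Fin n → Set} {p} → Closed K p → Closed (¬_ ∘ K) p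
closed-complement (to , from) = (λ ¬x y → ¬x (from y)) , (λ ¬y x → ¬y (to x))

prodR-preserves : ∀ {n} (P : SInt n → Set) (L : List (Root n)) →
                  (∀ e y → P y → P (reflect (lookup L e) y)) → ∀ y → P y → P (prodR L y)
prodR-preserves P []      _    y py = py
prodR-preserves P (r ∷ L) pres y py = pres zero _ (prodR-preserves P L (pres ∘ suc) y py)

iter-preserves : ∀ {A : Set} (P : A → Set) (f : A → A) → (∀ y → P y → P (f y)) → ∀ t y → P y → P (iter f t y)
iter-preserves P f pres zero    y py = py
iter-preserves P f pres (suc t) y py = pres _ (iter-preserves P f pres t y py)

prodR-one-separating : ∀ {n} (K : Fin n → Set) σ (L : List (Root n)) k →
  (∀ e → e ≢ k → Compatible K σ (lookup L e)) → ¬ (K (Root.a (lookup L k)) × K (Root.b (lookup L k))) →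
  ∀ y → InSigned K σ y → InSigned K σ (prodR L y) ⊎ ¬ K (abs (prodR L y))
prodR-one-separating K σ (r ∷ L) zero compat sep y y∈ =
  reflect-separating {K = K} {r} {σ} sep _
    (prodR-preserves (InSigned K σ) L (λ e → reflect-compatible {K = K} {lookup L e} {σ} (compat (suc e) λ ())) y y∈)
prodR-one-separating K σ (r ∷ L) (suc k) compat sep y y∈
  with prodR-one-separating K σ L k (λ e e≢k → compat (suc e) (e≢k ∘ suc-injective)) sep y y∈
... | inj₁ inside  = inj₁ (reflect-compatible {K = K} {r} {σ} (compat zero λ ()) _ inside)
... | inj₂ outside = inj₂ (reflect-closed {K = ¬_ ∘ K} {r} (closed-complement {K = K} (proj₁ (compat zero λ ()))) _ outside)

-- Orbits

injective-endo-surjective : ∀ {N} (f : Fin N → Fin N) → (∀ {i j} → f i ≡ f j → i ≡ j) → ∀ y → ∃ λ i → f i ≡ y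
injective-endo-surjective {suc N} f inj y with any? (λ i → f i ≟ y)
... | yes hit = hit
... | no miss = contradiction (injective⇒≤ {f = missed} (λ eq → inj (punchOut-injective {i = y} _ _ eq))) ℕ.1+n≰n
  where
  missed : Fin (suc N) → Fin N
  missed i = punchOut {i = y} {j = f i} (λ y≡fi → miss (i , sym y≡fi))

iter-+ : ∀ {A : Set} (f : A → A) i j x → iter f (i + j) x ≡ iter f i (iter f j x)
iter-+ f zero    j x = refl
iter-+ f (suc i) j x = cong f (iter-+ f i j x)

module _ {A : Set} {N} (f : A → A) (x : A) (P : A → Set) (code : A → Fin N)
  (code-injective : ∀ {y z} → P y → P z → code y ≡ code z → y ≡ z)
  (orbit-in : ∀ i → i < N → P (iter f i x))
  (orbit-distinct : ∀ i j → i < N → j < N → iter f i x ≡ iter f j x → i ≡ j)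
  (periodic : iter f N x ≡ x) where

  orbit-covers : ∀ {y} → P y → ∃ λ i → i < N × iter f i x ≡ y
  orbit-covers {y} py with injective-endo-surjective (λ i → code (iter f (toℕ i) x)) injective (code y)
    where
    injective : ∀ {i j} → code (iter f (toℕ i) x) ≡ code (iter f (toℕ j) x) → i ≡ j
    injective {i} {j} eq = toℕ-injective (orbit-distinct _ _ (toℕ<n i) (toℕ<n j)
      (code-injective (orbit-in _ (toℕ<n i)) (orbit-in _ (toℕ<n j)) eq))
  ... | i , eq = toℕ i , toℕ<n i , code-injective (orbit-in _ (toℕ<n i)) py eq

  orbit-transitive : ∀ {y z} → P y → P z → ∃ λ t → iter f t y ≡ z
  orbit-transitive py pz with orbit-covers py | orbit-covers pz
  ... | i , i<N , refl | j , _ , refl = j + (N ∸ i) , (begin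
    iter f (j + (N ∸ i)) (iter f i x) ≡⟨ iter-+ f (j + (N ∸ i)) i x ⟨
    iter f (j + (N ∸ i) + i) x       ≡⟨ cong (λ t → iter f t x) (trans (ℕ.+-assoc j (N ∸ i) i) (cong (j +_) (ℕ.m∸n+n≡m (ℕ.<⇒≤ i<N)))) ⟩
    iter f (j + N) x                 ≡⟨ iter-+ f j N x ⟩
    iter f j (iter f N x)            ≡⟨ cong (iter f j) periodic ⟩
    iter f j x                       ∎)
    where open ≡-Reasoning

cycle-type-swaps-one : ∀ {m} {c : SInt (suc m) → SInt (suc m)} → HasCycleType (suc m) c →
                       ∀ s → c (s , zero) ≡ (not s , zero)
cycle-type-swaps-one (c+ , _ , _) false = c+
cycle-type-swaps-one (_ , c- , _) true  = c-

module _ (p : ℕ) where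

  -- numbers the 2n − 2 signed integers of absolute value at least 2 (n = p + 2); junk at ±1
  code : SInt (suc (suc p)) → Fin (suc p + suc p)
  code (_     , zero)  = zero
  code (false , suc j) = j ↑ˡ suc p
  code (true  , suc j) = suc p ↑ʳ j

  decode : Fin (suc p + suc p) → SInt (suc (suc p))
  decode i = [ (λ j → false , suc j) , (λ j → true , suc j) ]′ (splitAt (suc p) i)

  decode-code : ∀ {y} → abs y ≢ zero → decode (code y) ≡ y
  decode-code {_ , zero} y≢0 = contradiction refl y≢0
  decode-code {false , suc j} _ rewrite splitAt-↑ˡ (suc p) j (suc p) = refl
  decode-code {true  , suc j} _ rewrite splitAt-↑ʳ (suc p) (suc p) j = refl

  orbit-length : 2 * suc (suc p) ∸ 2 ≡ suc p + suc p
  orbit-length = trans (cong (p +_) (ℕ.+-identityʳ (suc (suc p)))) (ℕ.+-suc p (suc p))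

  cycle-type-transitive : ∀ {c} → HasCycleType (suc (suc p)) c →
                          ∀ y z → abs y ≢ zero → abs z ≢ zero → ∃ λ t → iter c t y ≡ z
  cycle-type-transitive {c} (_ , _ , k₁ , in-orbit , distinct , periodic) y z y≢0 z≢0 =
    orbit-transitive c k₁ (λ y → abs y ≢ zero) code
      (λ y≢0 z≢0 eq → trans (sym (decode-code y≢0)) (trans (cong decode eq) (decode-code z≢0)))
      (λ i i<N → in-orbit i (subst (i <_) (sym orbit-length) i<N))
      (λ i j i<N j<N → distinct i j (subst (i <_) (sym orbit-length) i<N) (subst (j <_) (sym orbit-length) j<N))
      (subst (λ N → iter c N k₁ ≡ k₁) orbit-length periodic) y≢0 z≢0

-- Coxeter elements have factorizations of length n

module _ {n} (r : Root n) (s : Bool) where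

  reflect-at-a : reflect r (s , Root.a r) ≡ (Root.plus r xor s , Root.b r)
  reflect-at-a with reflect-view r s (Root.a r)
  ... | inj₁ (_ , eq)              = eq
  ... | inj₂ (inj₁ (a≡b , _))      = contradiction a≡b (Root.a≢b r)
  ... | inj₂ (inj₂ (a≢a , _))      = contradiction refl a≢a

  reflect-at-b : reflect r (s , Root.b r) ≡ (Root.plus r xor s , Root.a r)
  reflect-at-b with reflect-view r s (Root.b r)
  ... | inj₁ (b≡a , _)             = contradiction (sym b≡a) (Root.a≢b r)
  ... | inj₂ (inj₁ (_ , eq))       = eq
  ... | inj₂ (inj₂ (_ , b≢b , _))  = contradiction refl b≢b

  reflect-elsewhere : ∀ {i} → i ≢ Root.a r → i ≢ Root.b r → reflect r (s , i) ≡ (s , i)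
  reflect-elsewhere {i} i≢a i≢b with reflect-view r s i
  ... | inj₁ (i≡a , _)             = contradiction i≡a i≢a
  ... | inj₂ (inj₁ (i≡b , _))      = contradiction i≡b i≢b
  ... | inj₂ (inj₂ (_ , _ , eq))   = eq

module Conjugation {n} (w w⁻¹ : SInt n → SInt n) (w-neg : ∀ x → w (neg x) ≡ neg (w x))
  (w⁻¹∘w : ∀ x → w⁻¹ (w x) ≡ x) (w∘w⁻¹ : ∀ x → w (w⁻¹ x) ≡ x) where

  twist : Fin n → Bool
  twist i = proj₁ (w (false , i))

  image : Fin n → Fin n
  image i = proj₂ (w (false , i))

  w-form : ∀ s i → w (s , i) ≡ (s xor twist i , image i)
  w-form false i = refl
  w-form true  i = w-neg (false , i)

  image-injective : ∀ {i j} → image i ≡ image j → i ≡ j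
  image-injective {i} {j} eq = sym (cong abs (begin
    (twist i xor twist j , j)          ≡⟨ w⁻¹∘w _ ⟨
    w⁻¹ (w (twist i xor twist j , j))  ≡⟨ cong w⁻¹ (trans (w-form _ j) (cong₂ _,_ (xor-cancelʳ (twist i) (twist j)) (sym eq))) ⟩
    w⁻¹ (w (false , i))                ≡⟨ w⁻¹∘w _ ⟩
    (false , i)                        ∎))
    where open ≡-Reasoning

  -- the root of w ∘ reflect r ∘ w⁻¹, read off from w-form
  conjugate : Root n → Root n
  conjugate (mkRoot a b a≢b p) = mkRoot (image a) (image b) (a≢b ∘ image-injective) (p xor (twist a xor twist b))

  conjugate-reflect : ∀ r y → reflect (conjugate r) (w y) ≡ w (reflect r y)
  conjugate-reflect r@(mkRoot a b _ p) (s , i) rewrite w-form s i with reflect-view r s i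
  ... | inj₁ (refl , eq) rewrite eq =
        trans (reflect-at-a (conjugate r) (s xor twist a))
              (trans (cong (_, image b) (xor-conjugate p s (twist a) (twist b))) (sym (w-form _ b)))
  ... | inj₂ (inj₁ (refl , eq)) rewrite eq =
        trans (reflect-at-b (conjugate r) (s xor twist b))
              (trans (cong (_, image a) (trans (cong (λ t → (p xor t) xor (s xor twist b)) (xor-comm (twist a) (twist b)))
                                                (xor-conjugate p s (twist b) (twist a))))
                     (sym (w-form _ a)))
  ... | inj₂ (inj₂ (i≢a , i≢b , eq)) rewrite eq =
        trans (reflect-elsewhere (conjugate r) _ (i≢a ∘ image-injective) (i≢b ∘ image-injective)) (sym (w-form s i))

  prodR-conjugate : ∀ L x → prodR (map conjugate L) x ≡ w (prodR L (w⁻¹ x))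
  prodR-conjugate []      x = sym (w∘w⁻¹ x)
  prodR-conjugate (r ∷ L) x = trans (cong (reflect (conjugate r)) (prodR-conjugate L x)) (conjugate-reflect r _)

coxeter-factorization : ∀ p {c} → IsCoxeter (suc (suc p)) c →
                        ∃ λ L → IsFactorization c L × length L ≡ suc (suc p)
coxeter-factorization p {c} (L , L↭simple , w , (w-neg , (w⁻¹ , w⁻¹∘w , w∘w⁻¹) , _) , c∘w) =
  map conjugate L ,
  (λ x → trans (prodR-conjugate L x) (trans (sym (c∘w (w⁻¹ x))) (cong c (w∘w⁻¹ x)))) ,
  trans (length-map conjugate L) (trans (↭-length L↭simple)
    (cong suc (trans (length-map _ (allFin (suc p))) (length-tabulate (λ i → i)))))
  where open Conjugation w w⁻¹ w-neg w⁻¹∘w w∘w⁻¹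

-- Factorizations of an element with cycle type (1,-1)(k₁ … k₂ₙ₋₂)

module FactorizationRigidity {n} (c : SInt (suc n) → SInt (suc n)) (L : List (Root (suc n)))
  (factorization : IsFactorization c L) (c-one : ∀ s → c (s , zero) ≡ (not s , zero))
  (transitive : ∀ y z → abs y ≢ zero → abs z ≢ zero → ∃ λ t → iter c t y ≡ z) where

  private
    E = lookup L

  c-preserves : (P : SInt (suc n) → Set) → (∀ e y → P y → P (reflect (E e) y)) → ∀ y → P y → P (c y)
  c-preserves P pres y py = subst P (factorization y) (prodR-preserves P L pres y py)

  sign-reversal : ∀ s v → ∃ λ t → iter c t (s , v) ≡ (not s , v)
  sign-reversal s zero    = 1 , c-one s
  sign-reversal s (suc v) = transitive (s , suc v) (not s , suc v) (λ ()) (λ ())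

  no-compatible-set : ∀ K σ → ∃ K → ¬ (∀ e → Compatible K σ (E e))
  no-compatible-set K σ (v , v∈K) compat with sign-reversal (σ v) v
  ... | t , eq = not-¬ refl (proj₂ (subst (InSigned K σ) eq
        (iter-preserves (InSigned K σ) c (c-preserves _ (λ e → reflect-compatible {K = K} {E e} {σ} (compat e))) t
                        (σ v , v) (v∈K , refl))))

  edge-at-one : ∃ λ e → Root.a (E e) ≡ zero ⊎ Root.b (E e) ≡ zero
  edge-at-one with any? (λ e → (Root.a (E e) ≟ zero) ⊎-dec (Root.b (E e) ≟ zero))
  ... | yes found = found
  ... | no none   = ⊥-elim (no-compatible-set (_≡ zero) (λ _ → false) (zero , refl)
                      (λ e → ((λ a≡0 → ⊥-elim (none (e , inj₁ a≡0))) , (λ b≡0 → ⊥-elim (none (e , inj₂ b≡0)))) ,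
                             (λ a≡0 → ⊥-elim (none (e , inj₁ a≡0)))))

  closed-set-full : ∀ K → ∃ K → (∀ e → Closed K (ends (E e))) → ∀ v → K v
  closed-set-full K (v , v∈K) closed w = spread-from-neighbour (neighbour edge-at-one)
    where
    spread : ∀ {u w} → u ≢ zero → w ≢ zero → K u → K w
    spread {u} {w} u≢0 w≢0 u∈K with transitive (false , u) (false , w) u≢0 w≢0
    ... | t , eq = subst (K ∘ abs) eq
          (iter-preserves (K ∘ abs) c (c-preserves _ (λ e → reflect-closed {K = K} {E e} (closed e))) t _ u∈K)
    neighbour : (∃ λ e → Root.a (E e) ≡ zero ⊎ Root.b (E e) ≡ zero) → ∃ λ x → x ≢ zero × Closed K (zero , x)
    neighbour (e , inj₁ a≡0) = Root.b (E e) , (λ b≡0 → Root.a≢b (E e) (trans a≡0 (sym b≡0))) ,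
                                subst (λ a → Closed K (a , Root.b (E e))) a≡0 (closed e)
    neighbour (e , inj₂ b≡0) = Root.a (E e) , (λ a≡0 → Root.a≢b (E e) (trans a≡0 (sym b≡0))) ,
                                subst (λ b → Closed K (b , Root.a (E e))) b≡0 (swap (closed e))
    spread-from-neighbour : (∃ λ x → x ≢ zero × Closed K (zero , x)) → K w
    spread-from-neighbour (x , x≢0 , to , from) with v ≟ zero | w ≟ zero
    ... | yes refl | yes refl = v∈K
    ... | yes refl | no w≢0   = spread x≢0 w≢0 (to v∈K)
    ... | no v≢0   | yes refl = from (spread v≢0 x≢0 v∈K)
    ... | no v≢0   | no w≢0   = spread v≢0 w≢0 v∈K

  no-separating-edge : ∀ K σ k → K zero → (∀ e → e ≢ k → Compatible K σ (E e)) →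
                       ¬ ¬ (K (Root.a (E k)) × K (Root.b (E k)))
  no-separating-edge K σ k 0∈K compat sep
    with subst (λ y → InSigned K σ y ⊎ ¬ K (abs y)) (trans (factorization _) (c-one (σ zero)))
           (prodR-one-separating K σ L k compat sep (σ zero , zero) (0∈K , refl))
  ... | inj₁ (_ , σ0≡not) = not-¬ refl σ0≡not
  ... | inj₂ 0∉K          = 0∉K 0∈K

-- The folded chord diagram

module RigidDiagram {n m} (E : Fin (suc m) → Root (suc n)) (edge-count : m ≡ n)
  (no-compatible-set : ∀ K σ → ∃ K → ¬ (∀ e → Compatible K σ (E e)))
  (closed-set-full : ∀ K → ∃ K → (∀ e → Closed K (ends (E e))) → ∀ v → K v)
  (no-separating-edge : ∀ K σ k → K zero → (∀ e → e ≢ k → Compatible K σ (E e)) →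
                        ¬ ¬ (K (Root.a (E k)) × K (Root.b (E k)))) where

  G : Graph (suc n) (suc m)
  G e = ends (E e)

  connected : Connected G
  connected u v = closed-set-full (λ w → Reachable G w v) (v , [] , _ , nil)
    (λ e → (λ { (_ , _ , p) → _ , _ , cons (inj₂ (refl , refl)) p }) ,
           (λ { (_ , _ , p) → _ , _ , cons (inj₁ (refl , refl)) p })) u

  record CompatibleExcept (g : Fin (suc m)) : Set₁ where
    field
      member       : Fin (suc n) → Set
      member?      : ∀ v → Dec (member v)
      sign         : Fin (suc n) → Bool
      compatible   : ∀ e → e ≢ g → Compatible member sign (E e)
      incompatible : ¬ Compatible member sign (E g)

  -- with one edge fewer than vertices, some signed set survives all other reflections
  compatible-except : ∀ g → CompatibleExcept g
  compatible-except g = record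
    { member = member ; member? = member? ; sign = sign ; compatible = compatible′
    ; incompatible = λ compat-g → no-compatible-set member sign nonempty (λ e → compatible-at e compat-g) }
    where
    open CompatibleSet (compatible-set-of-few-edges (E ∘ punchIn g) (ℕ.≤-reflexive (cong suc edge-count)))
    compatible′ : ∀ e → e ≢ g → Compatible member sign (E e)
    compatible′ e e≢g = subst (Compatible member sign ∘ E) (punchIn-punchOut (e≢g ∘ sym)) (compatible _)
    compatible-at : ∀ e → Compatible member sign (E g) → Compatible member sign (E e)
    compatible-at e compat-g with e ≟ g
    ... | yes refl = compat-g
    ... | no e≢g   = compatible′ e e≢g

  open CompatibleExcept

  private
    plus : Fin (suc m) → Bool
    plus e = Root.plus (E e)

    avoids : ∀ {g f : Fin (suc m)} {es} → g ∉ es → f ∈ es → f ≢ g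
    avoids g∉es f∈es refl = g∉es f∈es

    xor-sym : ∀ {e} (τ : Fin (suc n) → Bool) {u w} → plus e ≡ τ u xor τ w → plus e ≡ τ w xor τ u
    xor-sym τ {u} {w} eq = trans eq (xor-comm (τ u) (τ w))

  cycle-edge-unbalanced : ∀ {C g} → IsCycle G C → g ∈ C → (X : CompatibleExcept g) →
                          (∀ v → member X v) × ¬ Balanced (sign X) (E g)
  cycle-edge-unbalanced {g = g} cyc g∈C X with cycle-detour cyc g∈C
  ... | x , y , j , es , vs , p , g∉es = full , λ bal → incompatible X (closed-g , λ _ → bal)
    where
    K = member X
    detour-closed : Closed K (y , x)
    detour-closed = path-closed p (λ f∈es → proj₁ (compatible X _ (avoids g∉es f∈es)))
    closed-g : Closed K (ends (E g))
    closed-g = joins-transport {G = G} (λ u w → Closed K (u , w)) swap j (swap detour-closed)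
    x∈K : K x
    x∈K with member? X x
    ... | yes x∈K = x∈K
    ... | no x∉K  = ⊥-elim (incompatible X (uncurry (compatible-outside {K = K} {σ = sign X} {r = E g})
          (joins-transport {G = G} (λ u w → ¬ K u × ¬ K w) swap j (x∉K , x∉K ∘ proj₁ detour-closed))))
    full : ∀ v → K v
    full = closed-set-full K (x , x∈K) closed-all
      where
      closed-all : ∀ e → Closed K (ends (E e))
      closed-all e with e ≟ g
      ... | yes refl = closed-g
      ... | no e≢g   = proj₁ (compatible X e e≢g)

  balanced-cycle-impossible : ∀ {C} σ → IsCycle G C → ¬ (∀ {f} → f ∈ C → Balanced σ (E f))
  balanced-cycle-impossible {e ∷ es} σ cyc@(e∉es ∷ _ , u , v , _ , j , p , _) balanced
    with cycle-edge-unbalanced cyc (here refl) (compatible-except e)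
  ... | full , unbalanced =
    unbalanced (joins-transport {G = G} (λ x y → plus e ≡ τ x xor τ y) (xor-sym τ) j (begin
      plus e                          ≡⟨ joins-transport⁻¹ {G = G} (λ x y → plus e ≡ σ x xor σ y) (xor-sym σ) j (balanced (here refl)) ⟩
      σ u xor σ v                     ≡⟨ xor-comm (σ u) (σ v) ⟩
      σ v xor σ u                     ≡⟨ path-parity plus σ p (balanced ∘ there) ⟨
      foldr _xor_ false (map plus es) ≡⟨ path-parity plus τ p (λ f∈es → proj₂ (compatible X _ (e≢ f∈es)) (full _)) ⟩
      τ v xor τ u                     ≡⟨ xor-comm (τ v) (τ u) ⟩
      τ u xor τ v                     ∎))
    where
    open ≡-Reasoning
    X = compatible-except e
    τ = sign X
    e≢ : ∀ {f} → f ∈ es → f ≢ e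
    e≢ f∈es f≡e = All.lookup e∉es f∈es (sym f≡e)

  cycle-unique : ∀ {C C′} → IsCycle G C → IsCycle G C′ → ∀ {g} → g ∈ C → g ∈ C′
  cycle-unique {C′ = C′} cyc cyc′ {g} g∈C with g ∈? C′
  ... | yes g∈C′ = g∈C′
  ... | no g∉C′  = ⊥-elim (balanced-cycle-impossible (sign X) cyc′
                      (λ f∈C′ → proj₂ (compatible X _ (avoids g∉C′ f∈C′)) (proj₁ (cycle-edge-unbalanced cyc g∈C X) _)))
    where
    X = compatible-except g

  TouchesOne : Fin (suc m) → Set
  TouchesOne e = proj₁ (G e) ≡ zero ⊎ proj₂ (G e) ≡ zero

  cycle-avoiding-one-impossible : ∀ {e es} → IsCycle G (e ∷ es) → (∀ {f} → f ∈ e ∷ es → ¬ TouchesOne f) → ⊥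
  cycle-avoiding-one-impossible {e} {es} cyc avoids-one =
    from-last-visit (path-after-last-visit p₀ a≢0 (path-source∈ p₀))
    where
    a≢0 : proj₁ (G e) ≢ zero
    a≢0 a≡0 = avoids-one (here refl) (inj₁ a≡0)
    p₀ = proj₂ (proj₂ (connected zero (proj₁ (G e))))
    from-last-visit : (∃₂ λ f w → Joins (G f) zero w × ∃₂ λ es′ vs′ → Path G w (proj₁ (G e)) es′ vs′ × zero ∉ vs′) → ⊥
    -- f is the last chord at 1 on a walk from 1 to the cycle, w its other end
    from-last-visit (f , w , jf , es′ , vs′ , p , 0∉vs′) = decide (member? X w) (member? X zero)
      where
      X = compatible-except f
      K = member X
      f∉C : f ∉ e ∷ es
      f∉C f∈C = avoids-one f∈C (joins-end {G = G} jf)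
      f∉es′ : f ∉ es′
      f∉es′ f∈es′ with path-edge-ends∈ p f∈es′ | joins-end {G = G} jf
      ... | a∈vs′ , _ | inj₁ a≡0 = 0∉vs′ (subst (_∈ vs′) a≡0 a∈vs′)
      ... | _ , b∈vs′ | inj₂ b≡0 = 0∉vs′ (subst (_∈ vs′) b≡0 b∈vs′)
      decide : Dec (K w) → Dec (K zero) → ⊥
      decide (yes w∈K) _ = balanced-cycle-impossible (sign X) cyc
        (λ g∈C → proj₂ (compatible X _ (avoids f∉C g∈C)) (inside g∈C))
        where
        inside = cycle-closed-inside {K = K} cyc (λ g∈C → proj₁ (compatible X _ (avoids f∉C g∈C)))
                   (proj₁ (path-closed {K = K} p (λ g∈es′ → proj₁ (compatible X _ (avoids f∉es′ g∈es′)))) w∈K)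
      decide (no w∉K) (yes 0∈K) = no-separating-edge K (sign X) f 0∈K (compatible X)
        (λ ends∈K → w∉K (proj₂ (joins-transport⁻¹ {G = G} (λ x y → K x × K y) swap jf ends∈K)))
      decide (no w∉K) (no 0∉K) = incompatible X (uncurry (compatible-outside {K = K} {σ = sign X} {r = E f})
        (joins-transport {G = G} (λ x y → ¬ K x × ¬ K y) swap jf (0∉K , w∉K)))

  cycle-through-one : ∀ {C} → IsCycle G C → CycleContains G C zero
  cycle-through-one {C} cyc with Any.any? (λ e → (proj₁ (G e) ≟ zero) ⊎-dec (proj₂ (G e) ≟ zero)) C
  ... | yes touching = find touching
  cycle-through-one {_ ∷ _} cyc | no avoiding = ⊥-elim (cycle-avoiding-one-impossible cyc (λ f∈C t → avoiding (lose f∈C t)))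

minimal-factorization-length : ∀ p {c} → IsCoxeter (suc (suc p)) c → HasCycleType (suc (suc p)) c →
                               ∀ {L} → IsMinimalFactorization c L → length L ≡ suc (suc p)
minimal-factorization-length p {c} coxeter cycle-type {L} (factorization , minimal)
  with coxeter-factorization p coxeter
... | L₀ , factorization₀ , length₀ =
  ℕ.≤-antisym (subst (length L ≤_) length₀ (minimal L₀ factorization₀)) (ℕ.≮⇒≥ not-shorter)
  where
  open FactorizationRigidity c L factorization (cycle-type-swaps-one cycle-type) (cycle-type-transitive p cycle-type)
  not-shorter : ¬ length L < suc (suc p)
  not-shorter shorter = no-compatible-set member sign nonempty compatible
    where open CompatibleSet (compatible-set-of-few-edges (lookup L) shorter)

mainTheorem6 : ∀ (m : ℕ) (c : SInt (suc m) → SInt (suc m)) → IsCoxeter (suc m) c → HasCycleType (suc m) c →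
    ∀ (L : List (Root (suc m))) → IsMinimalFactorization c L →
      Connected (chordDiagram L) ×
      length L ≡ suc m ×
      Σ (List (Fin (length L))) (λ C →
        IsCycle (chordDiagram L) C ×
        (∀ C' → IsCycle (chordDiagram L) C' → SameEdges C C') ×
        2 ≤ length C ×
        CycleContains (chordDiagram L) C zero)
mainTheorem6 zero c _ cycle-type [] (factorization , _) with trans (factorization (false , zero)) (proj₁ cycle-type)
... | ()
mainTheorem6 zero c _ _ (mkRoot zero zero a≢b _ ∷ _) _ = contradiction refl a≢b
mainTheorem6 (suc p) c coxeter cycle-type L minimal with minimal-factorization-length p coxeter cycle-type {L} minimal
mainTheorem6 (suc p) c coxeter cycle-type (r ∷ L) (factorization , _) | len =
  connected , len , C , cycle ,
  (λ C′ cycle′ e → cycle-unique cycle cycle′ , cycle-unique cycle′ cycle) ,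
  cycle-length≥2 (λ e → Root.a≢b (lookup (r ∷ L) e)) cycle , cycle-through-one cycle
  where
  open FactorizationRigidity c (r ∷ L) factorization (cycle-type-swaps-one cycle-type) (cycle-type-transitive p cycle-type)
  open RigidDiagram (lookup (r ∷ L)) (ℕ.suc-injective {length L} len) no-compatible-set closed-set-full no-separating-edge
  found = cycle-of-many-edges G (ℕ.≤-reflexive (sym len))
  C = proj₁ found
  cycle = proj₂ found
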